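{- Let $t,d,s$ be positive integers with $d>1$, and let $p$ be a prime such that $q=p^s \equiv 1 \pmod {2d}$. Suppose there is a proper subfield $K$ of $\mathbb{F}_q$ with $|K|=p^t$ such that $K$ forms a clique in $GP(q,d)$. Then there is a $K$-subspace $V$ of $\mathbb{F}_q$ such that $K \subset V$, $\dim_{K} V \leq \frac{s}{2t}$, and $V$ forms a maximal clique in $GP(q,d)$.
   Context: For a prime power $q$ and integer $d>1$ with $q\equiv 1 \pmod{2d}$, the $d$-Paley graph $GP(q,d)$ has vertex set $\mathbb{F}_q$, two vertices being adjacent iff their difference lies in $\{x^d : x\in\mathbb{F}_q^*\}$. A clique is a set of pairwise adjacent vertices; it is maximal if no further vertex can be added while remaining a clique. -}

module Defs where

open import Level using (0ℓ)
open import Data.Nat using (ℕ; zero; suc)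
open import Data.Fin using (Fin)
import Data.Fin as Fin
open import Data.Product using (Σ; ∃; _×_; _,_)
open import Data.Sum using (_⊎_)
open import Relation.Nullary using (¬_)
open import Relation.Unary using (Pred; _⊆_)
open import Relation.Binary.PropositionalEquality using (_≡_; _≢_)
open import Function.Definitions using (Injective)
open import Algebra.Core using (Op₁; Op₂)
open import Algebra.Structures using (IsCommutativeRing)

record Field : Set₁ where
  infixl 6 _+_ _-_
  infixl 7 _*_
  field
    Carrier : Set
    _+_ _*_ : Op₂ Carrier
    -_ : Op₁ Carrier
    0# 1# : Carrier
    isCommutativeRing : IsCommutativeRing _≡_ _+_ _*_ -_ 0# 1#
    0≢1 : 0# ≢ 1#
    inverse : ∀ x → x ≢ 0# → Σ Carrier (λ y → x * y ≡ 1#)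

  _-_ : Op₂ Carrier
  x - y = x + (- y)

  pow : Carrier → ℕ → Carrier
  pow x zero = 1#
  pow x (suc n) = x * pow x n

  linComb : ∀ {n} → (Fin n → Carrier) → (Fin n → Carrier) → Carrier
  linComb {zero} c b = 0#
  linComb {suc n} c b = (c Fin.zero * b Fin.zero) + linComb (λ i → c (Fin.suc i)) (λ i → b (Fin.suc i))

HasSize : {A : Set} → Pred A 0ℓ → ℕ → Set
HasSize {A} P n =
  Σ (Fin n → A) λ e → Injective _≡_ _≡_ e × (∀ i → P (e i)) × (∀ x → P x → ∃ λ i → e i ≡ x)

module _ (F : Field) where
  open Field F

  FieldSize : ℕ → Set
  FieldSize q = HasSize {Carrier} (λ _ → Data.Unit.⊤) q
    where import Data.Unit

  IsSubfield : Pred Carrier 0ℓ → Set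
  IsSubfield K =
    K 0# × K 1# ×
    (∀ {x y} → K x → K y → K (x + y)) ×
    (∀ {x} → K x → K (- x)) ×
    (∀ {x y} → K x → K y → K (x * y)) ×
    (∀ {x} → (x≢0 : x ≢ 0#) → K x → ∀ {y} → x * y ≡ 1# → K y)

  IsProper : Pred Carrier 0ℓ → Set
  IsProper K = ∃ λ x → ¬ K x

  IsSubspace : Pred Carrier 0ℓ → Pred Carrier 0ℓ → Set
  IsSubspace K V =
    V 0# ×
    (∀ {x y} → V x → V y → V (x + y)) ×
    (∀ {c x} → K c → V x → V (c * x))

  -- b : Fin n → F is a K-basis of V (so dim_K V = n)
  IsBasis : Pred Carrier 0ℓ → Pred Carrier 0ℓ → ∀ {n} → (Fin n → Carrier) → Set
  IsBasis K V {n} b =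
    (∀ i → V (b i)) ×
    (∀ v → V v → Σ (Fin n → Carrier) λ c → (∀ i → K (c i)) × linComb c b ≡ v) ×
    (∀ (c : Fin n → Carrier) → (∀ i → K (c i)) → linComb c b ≡ 0# → ∀ i → c i ≡ 0#)

  -- difference is a nonzero d-th power: the connection set of GP(q,d)
  IsDthPower : ℕ → Carrier → Set
  IsDthPower d z = ∃ λ x → x ≢ 0# × pow x d ≡ z

  Adjacent : ℕ → Carrier → Carrier → Set
  Adjacent d x y = IsDthPower d (x - y)

  IsClique : ℕ → Pred Carrier 0ℓ → Set
  IsClique d S = ∀ {x y} → S x → S y → x ≢ y → Adjacent d x y

  IsMaximalClique : ℕ → Pred Carrier 0ℓ → Set
  IsMaximalClique d S =
    IsClique d S × (∀ z → ¬ S z → ¬ IsClique d (λ x → S x ⊎ x ≡ z))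

-- Start from the K-basis (1) of K and keep adjoining a vector v whose differences with all elements of the current
-- span V are nonzero d-th powers: the span stays a K-subspace and a clique, and once no such v exists it is a maximal
-- clique. The dimension stays small because F has a nonzero non-d-th power ξ (otherwise y ^ ((q - 1) / d) = 1 for
-- all q - 1 units, too many roots): as V is a clique, (x , y) ↦ x + ξ y is injective on V × V, so |K| ^ (2 n) ≤ q.
module Submission where

open import Level using (0ℓ)
open import Function using (_∘_)
open import Function.Definitions using (Injective)
open import Data.Empty using (⊥-elim)
open import Data.Unit using (⊤; tt)
open import Data.Product using (Σ; ∃; _×_; _,_; proj₁; proj₂; uncurry)
open import Data.Sum using (inj₁; inj₂)
open import Data.Nat as ℕ using (ℕ; zero; suc; _≤_; _<_)
import Data.Nat.Properties as ℕₚ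
open import Data.Nat.Divisibility as Div using (_∣_; divides)
open import Data.Nat.Primality using (Prime; prime⇒nonTrivial)
open import Data.Fin using (Fin)
import Data.Fin as Fin
import Data.Fin.Properties as Finₚ
import Data.Fin.Permutation as Permutation
import Data.Vec.Functional as V
open import Data.List using (List; []; _∷_; length; tabulate)
import Data.List.Properties as Listₚ
open import Data.List.Relation.Unary.All as All using (All; []; _∷_)
import Data.List.Relation.Unary.All.Properties as Allₚ
open import Data.List.Relation.Unary.AllPairs using (AllPairs; []; _∷_)
import Data.List.Relation.Unary.AllPairs.Properties as AllPairsₚ
open import Relation.Binary.PropositionalEquality
open import Relation.Binary.Definitions using (DecidableEquality)
open import Relation.Nullary using (Dec; yes; no; ¬_; ¬?)
import Relation.Nullary.Decidable as Dec
open import Relation.Nullary.Decidable using (_×-dec_; _→-dec_)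
open import Relation.Unary using (Pred; Decidable; _⊆_)
open import Algebra.Bundles using (CommutativeRing)
open import Algebra.Structures using (IsCommutativeRing)
import Algebra.Properties.Ring as RingProperties
import Algebra.Properties.CommutativeSemiring.Exp as ExpProperties
import Algebra.Properties.CommutativeMonoid.Sum as ProductProperties

open import Defs

module Enumeration {A : Set} {P : Pred A 0ℓ} {n : ℕ} (enum : HasSize P n) where

  enumerate : Fin n → A
  enumerate = proj₁ enum

  enumerate-injective : Injective _≡_ _≡_ enumerate
  enumerate-injective = proj₁ (proj₂ enum)

  enumerate-∈ : ∀ i → P (enumerate i)
  enumerate-∈ = proj₁ (proj₂ (proj₂ enum))

  index : ∀ x → P x → Fin n
  index x px = proj₁ (proj₂ (proj₂ (proj₂ enum)) x px)

  enumerate-index : ∀ x px → enumerate (index x px) ≡ x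
  enumerate-index x px = proj₂ (proj₂ (proj₂ (proj₂ enum)) x px)

  index-injective : ∀ {x y} px py → index x px ≡ index y py → x ≡ y
  index-injective {x} {y} px py eq =
    trans (sym (enumerate-index x px)) (trans (cong enumerate eq) (enumerate-index y py))

  ∃? : {Q : Pred A 0ℓ} → Decidable Q → Dec (∃ λ x → P x × Q x)
  ∃? {Q} Q? = Dec.map′
    (λ (i , qi) → enumerate i , enumerate-∈ i , qi)
    (λ (x , px , qx) → index x px , subst Q (sym (enumerate-index x px)) qx)
    (Finₚ.any? (Q? ∘ enumerate))

  injection⇒≤ : ∀ {m} (f : Fin m → A) → (∀ i → P (f i)) → Injective _≡_ _≡_ f → m ≤ n
  injection⇒≤ f f∈P f-inj =
    Finₚ.injective⇒≤ {f = λ i → index (f i) (f∈P i)} (λ eq → f-inj (index-injective _ _ eq))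

module TotalEnumeration {A : Set} {n : ℕ} (enum : HasSize {A} (λ _ → ⊤) n) where
  open Enumeration enum public using (enumerate; enumerate-injective)
  private module E = Enumeration enum

  index : A → Fin n
  index x = E.index x tt

  enumerate-index : ∀ x → enumerate (index x) ≡ x
  enumerate-index x = E.enumerate-index x tt

  _≟_ : DecidableEquality A
  x ≟ y = Dec.map′ (E.index-injective tt tt) (cong index) (index x Finₚ.≟ index y)

  ∃? : {Q : Pred A 0ℓ} → Decidable Q → Dec (∃ Q)
  ∃? Q? = Dec.map′ (λ (x , _ , qx) → x , qx) (λ (x , qx) → x , tt , qx) (E.∃? Q?)

  ∀? : {Q : Pred A 0ℓ} → Decidable Q → Dec (∀ x → Q x)
  ∀? {Q} Q? = Dec.map′
    (λ all x → subst Q (enumerate-index x) (all (index x)))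
    (λ all i → all (enumerate i))
    (Finₚ.all? (Q? ∘ enumerate))

  injection⇒≤ : ∀ {m} (f : Fin m → A) → Injective _≡_ _≡_ f → m ≤ n
  injection⇒≤ f = E.injection⇒≤ f (λ _ → tt)

finToFun-injective : ∀ {m n} {a a′ : Fin (m ℕ.^ n)} →
                     (∀ i → Fin.finToFun {m} {n} a i ≡ Fin.finToFun a′ i) → a ≡ a′
finToFun-injective {m} {n} {a} {a′} eq = begin
  a                                            ≡⟨ Finₚ.funToFin-finToFin {n} {m} a ⟨
  Fin.funToFin (Fin.finToFun {m} {n} a)        ≡⟨ funToFin-cong {n} eq ⟩
  Fin.funToFin (Fin.finToFun {m} {n} a′)       ≡⟨ Finₚ.funToFin-finToFin {n} {m} a′ ⟩
  a′                                           ∎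
  where
  open ≡-Reasoning
  funToFin-cong : ∀ {k} {f g : Fin k → Fin m} → (∀ i → f i ≡ g i) → Fin.funToFin f ≡ Fin.funToFin g
  funToFin-cong {zero}  eq = refl
  funToFin-cong {suc k} eq = cong₂ Fin.combine (eq Fin.zero) (funToFin-cong (eq ∘ Fin.suc))

remQuot-injective : ∀ {m} n {i j : Fin (m ℕ.* n)} → Fin.remQuot {m} n i ≡ Fin.remQuot n j → i ≡ j
remQuot-injective {m} n {i} {j} eq = begin
  i                                            ≡⟨ Finₚ.combine-remQuot {m} n i ⟨
  uncurry Fin.combine (Fin.remQuot {m} n i)    ≡⟨ cong (uncurry Fin.combine) eq ⟩
  uncurry Fin.combine (Fin.remQuot {m} n j)    ≡⟨ Finₚ.combine-remQuot {m} n j ⟩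
  j                                            ∎
  where open ≡-Reasoning

cofactor-bound : ∀ {q m d} → 2 ≤ q → 2 ≤ d → q ℕ.∸ 1 ≡ suc m ℕ.* d → suc m ℕ.+ 2 ≤ q
cofactor-bound {suc q′} {m} {d} _ 2≤d q′≡ = begin
  suc m ℕ.+ 2               ≡⟨ ℕₚ.+-suc (suc m) 1 ⟩
  suc (suc m ℕ.+ 1)         ≤⟨ ℕ.s≤s (ℕₚ.+-monoʳ-≤ (suc m) (ℕ.s≤s ℕ.z≤n)) ⟩
  suc (suc m ℕ.+ suc m)     ≡⟨ cong (λ n → suc (suc m ℕ.+ n)) (ℕₚ.+-identityʳ (suc m)) ⟨
  suc (2 ℕ.* suc m)         ≡⟨ cong suc (ℕₚ.*-comm 2 (suc m)) ⟩
  suc (suc m ℕ.* 2)         ≤⟨ ℕ.s≤s (ℕₚ.*-monoʳ-≤ (suc m) 2≤d) ⟩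
  suc (suc m ℕ.* d)         ≡⟨ cong suc q′≡ ⟨
  suc q′                    ∎
  where open ℕₚ.≤-Reasoning

n<m^n : ∀ {m} n → 2 ≤ m → n < m ℕ.^ n
n<m^n {m} zero    _   = ℕ.s≤s ℕ.z≤n
n<m^n {m} (suc n) 2≤m = begin-strict
  suc n                  <⟨ ℕ.s≤s (n<m^n n 2≤m) ⟩
  suc (m ℕ.^ n)          ≤⟨ ℕₚ.+-monoˡ-≤ (m ℕ.^ n) (ℕₚ.≤-trans (ℕ.s≤s ℕ.z≤n) (n<m^n n 2≤m)) ⟩
  m ℕ.^ n ℕ.+ m ℕ.^ n    ≡⟨ cong (m ℕ.^ n ℕ.+_) (ℕₚ.+-identityʳ (m ℕ.^ n)) ⟨
  2 ℕ.* m ℕ.^ n          ≤⟨ ℕₚ.*-monoˡ-≤ (m ℕ.^ n) 2≤m ⟩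
  m ℕ.* m ℕ.^ n          ∎
  where open ℕₚ.≤-Reasoning

^-cancelʳ-≤ : ∀ {p a b} → 1 < p → p ℕ.^ a ≤ p ℕ.^ b → a ≤ b
^-cancelʳ-≤ {p} 1<p pᵃ≤pᵇ = ℕₚ.≮⇒≥ (λ b<a → ℕₚ.<⇒≱ (ℕₚ.^-monoʳ-< p 1<p b<a) pᵃ≤pᵇ)

[pᵗ]ⁿ*[pᵗ]ⁿ≡p^[2tn] : ∀ p t n → (p ℕ.^ t) ℕ.^ n ℕ.* (p ℕ.^ t) ℕ.^ n ≡ p ℕ.^ (2 ℕ.* t ℕ.* n)
[pᵗ]ⁿ*[pᵗ]ⁿ≡p^[2tn] p t n = begin
  (p ℕ.^ t) ℕ.^ n ℕ.* (p ℕ.^ t) ℕ.^ n   ≡⟨ cong₂ ℕ._*_ (ℕₚ.^-*-assoc p t n) (ℕₚ.^-*-assoc p t n) ⟩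
  p ℕ.^ (t ℕ.* n) ℕ.* p ℕ.^ (t ℕ.* n)   ≡⟨ ℕₚ.^-distribˡ-+-* p (t ℕ.* n) (t ℕ.* n) ⟨
  p ℕ.^ (t ℕ.* n ℕ.+ t ℕ.* n)           ≡⟨ cong (λ e → p ℕ.^ (t ℕ.* n ℕ.+ e)) (ℕₚ.+-identityʳ (t ℕ.* n)) ⟨
  p ℕ.^ (2 ℕ.* (t ℕ.* n))               ≡⟨ cong (p ℕ.^_) (ℕₚ.*-assoc 2 t n) ⟨
  p ℕ.^ (2 ℕ.* t ℕ.* n)                 ∎
  where open ≡-Reasoning

module FieldProperties (F : Field) where
  open Field F
  open IsCommutativeRing isCommutativeRing
    using (+-identityˡ; +-identityʳ; -‿inverseʳ; *-assoc; *-comm; *-identityˡ; *-identityʳ; zeroʳ)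

  commutativeRing : CommutativeRing 0ℓ 0ℓ
  commutativeRing = record { isCommutativeRing = isCommutativeRing }

  open CommutativeRing commutativeRing using (ring; commutativeSemiring)
  open RingProperties ring public
    using (-‿distribˡ-*; -‿+-comm; -0#≈0#; +-cancelʳ;
           +-inverseˡ-unique; x∙y⁻¹≈ε⇒x≈y; x[y-z]≈xy-xz; [y-z]x≈yx-zx; ⁻¹-anti-homo‿-)
  open ExpProperties commutativeSemiring using (_^_; ^-distrib-*; ^-assocʳ)
  open import Algebra.Solver.Ring.NaturalCoefficients.Default commutativeSemiring
  open ≡-Reasoning

  x-y≡0⇒x≡y : ∀ {x y} → x - y ≡ 0# → x ≡ y
  x-y≡0⇒x≡y = x∙y⁻¹≈ε⇒x≈y _ _

  x≢y⇒x-y≢0 : ∀ {x y} → x ≢ y → x - y ≢ 0#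
  x≢y⇒x-y≢0 x≢y = x≢y ∘ x-y≡0⇒x≡y

  x+[y-x]≡y : ∀ x y → x + (y - x) ≡ y
  x+[y-x]≡y x y = begin
    x + (y - x)   ≡⟨ solve 3 (λ x y x⁻ → x :+ (y :+ x⁻) := y :+ (x :+ x⁻)) refl x y (- x) ⟩
    y + (x - x)   ≡⟨ cong (y +_) (-‿inverseʳ x) ⟩
    y + 0#        ≡⟨ +-identityʳ y ⟩
    y             ∎

  [x+y]-[z+w]≡[x-z]+[y-w] : ∀ x y z w → (x + y) - (z + w) ≡ (x - z) + (y - w)
  [x+y]-[z+w]≡[x-z]+[y-w] x y z w = begin
    (x + y) + - (z + w)      ≡⟨ cong ((x + y) +_) (-‿+-comm z w) ⟨
    (x + y) + (- z + - w)    ≡⟨ solve 4 (λ x y z⁻ w⁻ → (x :+ y) :+ (z⁻ :+ w⁻) := (x :+ z⁻) :+ (y :+ w⁻))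
                                  refl x y (- z) (- w) ⟩
    (x + - z) + (y + - w)    ∎

  x+y≡z⇒y≡z-x : ∀ {x y z} → x + y ≡ z → y ≡ z - x
  x+y≡z⇒y≡z-x {x} {y} {z} refl = sym (begin
    (x + y) - x     ≡⟨ solve 3 (λ x y x⁻ → (x :+ y) :+ x⁻ := y :+ (x :+ x⁻)) refl x y (- x) ⟩
    y + (x - x)     ≡⟨ cong (y +_) (-‿inverseʳ x) ⟩
    y + 0#          ≡⟨ +-identityʳ y ⟩
    y               ∎)

  1≢0 : 1# ≢ 0#
  1≢0 = 0≢1 ∘ sym

  inv : ∀ x → x ≢ 0# → Carrier
  inv x x≢0 = proj₁ (inverse x x≢0)

  *-inverseʳ : ∀ x (x≢0 : x ≢ 0#) → x * inv x x≢0 ≡ 1#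
  *-inverseʳ x x≢0 = proj₂ (inverse x x≢0)

  *-inverseˡ : ∀ x (x≢0 : x ≢ 0#) → inv x x≢0 * x ≡ 1#
  *-inverseˡ x x≢0 = trans (*-comm _ x) (*-inverseʳ x x≢0)

  *-cancelˡ-≢0 : ∀ {x y z} → x ≢ 0# → x * y ≡ x * z → y ≡ z
  *-cancelˡ-≢0 {x} {y} {z} x≢0 eq = begin
    y                   ≡⟨ cancel y ⟨
    inv x x≢0 * (x * y) ≡⟨ cong (inv x x≢0 *_) eq ⟩
    inv x x≢0 * (x * z) ≡⟨ cancel z ⟩
    z                   ∎
    where
    cancel : ∀ w → inv x x≢0 * (x * w) ≡ w
    cancel w = trans (sym (*-assoc _ x w)) (trans (cong (_* w) (*-inverseˡ x x≢0)) (*-identityˡ w))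

  *-≢0 : ∀ {x y} → x ≢ 0# → y ≢ 0# → x * y ≢ 0#
  *-≢0 {x} x≢0 y≢0 xy≡0 = y≢0 (*-cancelˡ-≢0 x≢0 (trans xy≡0 (sym (zeroʳ x))))

  inv-≢0 : ∀ x (x≢0 : x ≢ 0#) → inv x x≢0 ≢ 0#
  inv-≢0 x x≢0 x⁻≡0 = 1≢0 (trans (sym (*-inverseʳ x x≢0)) (trans (cong (x *_) x⁻≡0) (zeroʳ x)))

  x*y≡y⇒x≡1 : ∀ {x y} → y ≢ 0# → x * y ≡ y → x ≡ 1#
  x*y≡y⇒x≡1 {x} {y} y≢0 eq = *-cancelˡ-≢0 y≢0 (trans (*-comm y x) (trans eq (sym (*-identityʳ y))))

  pow≡^ : ∀ x n → pow x n ≡ x ^ n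
  pow≡^ x zero    = refl
  pow≡^ x (suc n) = cong (x *_) (pow≡^ x n)

  pow-distrib-* : ∀ x y n → pow (x * y) n ≡ pow x n * pow y n
  pow-distrib-* x y n
    rewrite pow≡^ (x * y) n | pow≡^ x n | pow≡^ y n = ^-distrib-* x y n

  pow-pow : ∀ x m n → pow (pow x m) n ≡ pow x (m ℕ.* n)
  pow-pow x m n rewrite pow≡^ (pow x m) n | pow≡^ x m | pow≡^ x (m ℕ.* n) = ^-assocʳ x m n

  pow-1# : ∀ n → pow 1# n ≡ 1#
  pow-1# zero    = refl
  pow-1# (suc n) = trans (*-identityˡ _) (pow-1# n)

  pow-≢0 : ∀ {x} n → x ≢ 0# → pow x n ≢ 0#
  pow-≢0 zero    x≢0 = 1≢0
  pow-≢0 (suc n) x≢0 = *-≢0 x≢0 (pow-≢0 n x≢0)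

  inv-unique : ∀ {x y} (x≢0 : x ≢ 0#) → x * y ≡ 1# → y ≡ inv x x≢0
  inv-unique {x} x≢0 xy≡1 = *-cancelˡ-≢0 x≢0 (trans xy≡1 (sym (*-inverseʳ x x≢0)))

  a+b≡c+e⇒b-e≡c-a : ∀ {a b c e} → a + b ≡ c + e → b - e ≡ c - a
  a+b≡c+e⇒b-e≡c-a {a} {b} {c} {e} eq = begin
    b - e                     ≡⟨ +-identityʳ _ ⟨
    (b - e) + 0#              ≡⟨ cong ((b - e) +_) (-‿inverseʳ a) ⟨
    (b - e) + (a - a)         ≡⟨ solve 4 (λ a a⁻ b e⁻ → (b :+ e⁻) :+ (a :+ a⁻) := (a :+ b) :+ (a⁻ :+ e⁻))
                                   refl a (- a) b (- e) ⟩
    (a + b) + (- a + - e)     ≡⟨ cong (_+ (- a + - e)) eq ⟩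
    (c + e) + (- a + - e)     ≡⟨ solve 4 (λ a⁻ c e e⁻ → (c :+ e) :+ (a⁻ :+ e⁻) := (c :+ a⁻) :+ (e :+ e⁻))
                                   refl (- a) c e (- e) ⟩
    (c - a) + (e - e)         ≡⟨ cong ((c - a) +_) (-‿inverseʳ e) ⟩
    (c - a) + 0#              ≡⟨ +-identityʳ _ ⟩
    c - a                     ∎

  module _ (d : ℕ) where

    dthPower-≢0 : ∀ {z} → IsDthPower F d z → z ≢ 0#
    dthPower-≢0 (x , x≢0 , xᵈ≡z) z≡0 = pow-≢0 d x≢0 (trans xᵈ≡z z≡0)

    dthPower-* : ∀ {a b} → IsDthPower F d a → IsDthPower F d b → IsDthPower F d (a * b)
    dthPower-* (x , x≢0 , xᵈ≡a) (y , y≢0 , yᵈ≡b) =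
      x * y , *-≢0 x≢0 y≢0 , trans (pow-distrib-* x y d) (cong₂ _*_ xᵈ≡a yᵈ≡b)

    dthPower-inv : ∀ {a} (pa : IsDthPower F d a) → IsDthPower F d (inv a (dthPower-≢0 pa))
    dthPower-inv {a} pa@(x , x≢0 , xᵈ≡a) = inv x x≢0 , inv-≢0 x x≢0 , inv-unique (dthPower-≢0 pa) (begin
      a * pow (inv x x≢0) d          ≡⟨ cong (_* pow (inv x x≢0) d) xᵈ≡a ⟨
      pow x d * pow (inv x x≢0) d    ≡⟨ pow-distrib-* x _ d ⟨
      pow (x * inv x x≢0) d          ≡⟨ cong (λ y → pow y d) (*-inverseʳ x x≢0) ⟩
      pow 1# d                       ≡⟨ pow-1# d ⟩
      1#                             ∎)

    clique-x+ξy-injective :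
      DecidableEquality Carrier → ∀ {S ξ} → IsClique F d S → ξ ≢ 0# → ¬ IsDthPower F d ξ →
      ∀ {x y x′ y′} → S x → S y → S x′ → S y′ → x + ξ * y ≡ x′ + ξ * y′ → x ≡ x′ × y ≡ y′
    clique-x+ξy-injective _≟_ {S} {ξ} clique ξ≢0 ξ-nonpower {x} {y} {x′} {y′} x∈S y∈S x′∈S y′∈S eq
      with y ≟ y′
    ... | yes refl = +-cancelʳ (ξ * y) x x′ eq , refl
    ... | no y≢y′ = ⊥-elim (ξ-nonpower (subst (IsDthPower F d) ξ≡ (dthPower-* [x′-x]ᵈ (dthPower-inv [y-y′]ᵈ))))
      where
      ξ[y-y′]≡x′-x : ξ * (y - y′) ≡ x′ - x
      ξ[y-y′]≡x′-x = trans (x[y-z]≈xy-xz ξ y y′) (a+b≡c+e⇒b-e≡c-a eq)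
      [y-y′]ᵈ : IsDthPower F d (y - y′)
      [y-y′]ᵈ = clique y∈S y′∈S y≢y′
      y-y′≢0 = dthPower-≢0 [y-y′]ᵈ
      [x′-x]ᵈ : IsDthPower F d (x′ - x)
      [x′-x]ᵈ = clique x′∈S x∈S λ x′≡x →
        *-≢0 ξ≢0 y-y′≢0 (trans ξ[y-y′]≡x′-x (trans (cong (_- x) x′≡x) (-‿inverseʳ x)))
      ξ≡ : (x′ - x) * inv (y - y′) y-y′≢0 ≡ ξ
      ξ≡ = begin
        (x′ - x) * inv (y - y′) y-y′≢0        ≡⟨ cong (_* inv (y - y′) y-y′≢0) ξ[y-y′]≡x′-x ⟨
        ξ * (y - y′) * inv (y - y′) y-y′≢0    ≡⟨ *-assoc ξ _ _ ⟩
        ξ * ((y - y′) * inv (y - y′) y-y′≢0)  ≡⟨ cong (ξ *_) (*-inverseʳ _ y-y′≢0) ⟩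
        ξ * 1#                                ≡⟨ *-identityʳ ξ ⟩
        ξ                                     ∎

  eval : List Carrier → Carrier → Carrier
  eval []       y = 0#
  eval (c ∷ cs) y = c + y * eval cs y

  deflate : Carrier → List Carrier → List Carrier
  deflate a []            = []
  deflate a (c ∷ [])      = []
  deflate a (c ∷ c′ ∷ cs) = eval (c′ ∷ cs) a ∷ deflate a (c′ ∷ cs)

  length-deflate : ∀ a c cs → length (deflate a (c ∷ cs)) ≡ length cs
  length-deflate a c []        = refl
  length-deflate a c (c′ ∷ cs) = cong suc (length-deflate a c′ cs)

  -- Evaluated at a + w rather than at an arbitrary point, so that each step is a semiring identity.
  eval-deflate : ∀ a w f → eval f (a + w) ≡ eval f a + w * eval (deflate a f) (a + w)
  eval-deflate a w [] = solve 2 (λ a w → con 0 := con 0 :+ w :* con 0) refl a w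
  eval-deflate a w (c ∷ []) = solve 3 (λ a w c → c :+ (a :+ w) :* con 0 := (c :+ a :* con 0) :+ w :* con 0) refl a w c
  eval-deflate a w (c ∷ c′ ∷ cs) = begin
    c + (a + w) * eval (c′ ∷ cs) (a + w)  ≡⟨ cong (λ t → c + (a + w) * t) (eval-deflate a w (c′ ∷ cs)) ⟩
    c + (a + w) * (E + w * Q)             ≡⟨ solve 5 (λ c w a E Q → c :+ (a :+ w) :* (E :+ w :* Q)
                                                                 := (c :+ a :* E) :+ w :* (E :+ (a :+ w) :* Q))
                                                refl c w a E Q ⟩
    (c + a * E) + w * (E + (a + w) * Q)   ∎
    where
    E = eval (c′ ∷ cs) a
    Q = eval (deflate a (c′ ∷ cs)) (a + w)

  deflate-root : ∀ {a b} f → a ≢ b → eval f a ≡ 0# → eval f b ≡ 0# → eval (deflate a f) b ≡ 0#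
  deflate-root {a} {b} f a≢b fa≡0 fb≡0 = *-cancelˡ-≢0 (x≢y⇒x-y≢0 (a≢b ∘ sym)) (begin
    (b - a) * g b             ≡⟨ +-identityˡ _ ⟨
    0# + (b - a) * g b        ≡⟨ cong (_+ (b - a) * g b) fa≡0 ⟨
    eval f a + (b - a) * g b  ≡⟨ eval-deflate-at-b ⟨
    eval f b                  ≡⟨ fb≡0 ⟩
    0#                        ≡⟨ zeroʳ _ ⟨
    (b - a) * 0#              ∎)
    where
    g = eval (deflate a f)
    eval-deflate-at-b : eval f b ≡ eval f a + (b - a) * g b
    eval-deflate-at-b = subst (λ y → eval f y ≡ eval f a + (b - a) * g y) (x+[y-x]≡y a b) (eval-deflate a (b - a) f)

  c+x*t≡0⇒c≡0 : ∀ x {c t} → c + x * t ≡ 0# → t ≡ 0# → c ≡ 0#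
  c+x*t≡0⇒c≡0 x {c} {t} eq t≡0 = begin
    c           ≡⟨ +-identityʳ c ⟨
    c + 0#      ≡⟨ cong (c +_) (zeroʳ x) ⟨
    c + x * 0#  ≡⟨ cong (λ t → c + x * t) t≡0 ⟨
    c + x * t   ≡⟨ eq ⟩
    0#          ∎

  deflate-zero : ∀ a f → eval f a ≡ 0# → All (_≡ 0#) (deflate a f) → All (_≡ 0#) f
  deflate-zero a []            _    _           = []
  deflate-zero a (c ∷ [])      fa≡0 _           = c+x*t≡0⇒c≡0 a fa≡0 refl ∷ []
  deflate-zero a (c ∷ c′ ∷ cs) fa≡0 (ga≡0 ∷ zs) = c+x*t≡0⇒c≡0 a fa≡0 ga≡0 ∷ deflate-zero a (c′ ∷ cs) ga≡0 zs

  vanishing⇒zero : ∀ as f → AllPairs _≢_ as → length f ≤ length as →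
                   All (λ a → eval f a ≡ 0#) as → All (_≡ 0#) f
  vanishing⇒zero as       []       _                  _           _              = []
  vanishing⇒zero (a ∷ as) (c ∷ cs) (a≢as ∷ distinct) (ℕ.s≤s len≤) (fa≡0 ∷ fas≡0) =
    deflate-zero a (c ∷ cs) fa≡0 (vanishing⇒zero as (deflate a (c ∷ cs)) distinct
      (subst (_≤ length as) (sym (length-deflate a c cs)) len≤)
      (All.zipWith (λ (a≢b , fb≡0) → deflate-root (c ∷ cs) a≢b fa≡0 fb≡0) (a≢as , fas≡0)))

  monomial : ℕ → List Carrier
  monomial zero    = 1# ∷ []
  monomial (suc k) = 0# ∷ monomial k

  length-monomial : ∀ k → length (monomial k) ≡ suc k
  length-monomial zero    = refl
  length-monomial (suc k) = cong suc (length-monomial k)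

  eval-monomial : ∀ k y → eval (monomial k) y ≡ pow y k
  eval-monomial zero    y = trans (cong (1# +_) (zeroʳ y)) (+-identityʳ 1#)
  eval-monomial (suc k) y = trans (+-identityˡ _) (cong (y *_) (eval-monomial k y))

  monomial-≢0 : ∀ k → ¬ All (_≡ 0#) (monomial k)
  monomial-≢0 zero    (1≡0 ∷ []) = 1≢0 1≡0
  monomial-≢0 (suc k) (_ ∷ zs)   = monomial-≢0 k zs

  2≤size : ∀ {P : Pred Carrier 0ℓ} {n} → HasSize P n → P 0# → P 1# → 2 ≤ n
  2≤size {P} enum P0 P1 = Enumeration.injection⇒≤ enum zeroOne zeroOne∈P zeroOne-injective
    where
    zeroOne : Fin 2 → Carrier
    zeroOne Fin.zero    = 0#
    zeroOne (Fin.suc _) = 1#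
    zeroOne∈P : ∀ i → P (zeroOne i)
    zeroOne∈P Fin.zero    = P0
    zeroOne∈P (Fin.suc _) = P1
    zeroOne-injective : Injective _≡_ _≡_ zeroOne
    zeroOne-injective {Fin.zero}          {Fin.zero}          _   = refl
    zeroOne-injective {Fin.zero}          {Fin.suc Fin.zero}  0≡1 = ⊥-elim (0≢1 0≡1)
    zeroOne-injective {Fin.suc Fin.zero}  {Fin.zero}          1≡0 = ⊥-elim (1≢0 1≡0)
    zeroOne-injective {Fin.suc Fin.zero}  {Fin.suc Fin.zero}  _   = refl

module Lagrange (F : Field) {n : ℕ} (size : FieldSize F (suc n)) where
  open Field F
  open FieldProperties F
  open TotalEnumeration size
  open IsCommutativeRing isCommutativeRing using (*-assoc; *-identityˡ; zeroʳ)
  open CommutativeRing commutativeRing using (commutativeSemiring; *-commutativeMonoid)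
  open import Algebra.Solver.Ring.NaturalCoefficients.Default commutativeSemiring
  open ProductProperties *-commutativeMonoid
    using () renaming (sum to ∏; sum-remove to ∏-remove; sum-permute to ∏-permute; sum-cong-≗ to ∏-cong)
  open ≡-Reasoning

  ∏-≢0 : ∀ {k} (f : Fin k → Carrier) → (∀ i → f i ≢ 0#) → ∏ f ≢ 0#
  ∏-≢0 {zero}  f f≢0 = 1≢0
  ∏-≢0 {suc k} f f≢0 = *-≢0 (f≢0 Fin.zero) (∏-≢0 (f ∘ Fin.suc) (f≢0 ∘ Fin.suc))

  ∏-scale : ∀ {k} x (f : Fin k → Carrier) → ∏ (λ i → x * f i) ≡ pow x k * ∏ f
  ∏-scale {zero}  x f = sym (*-identityˡ 1#)
  ∏-scale {suc k} x f = begin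
    x * f Fin.zero * ∏ (λ i → x * f (Fin.suc i))   ≡⟨ cong (x * f Fin.zero *_) (∏-scale x (f ∘ Fin.suc)) ⟩
    x * f Fin.zero * (pow x k * ∏ (f ∘ Fin.suc))   ≡⟨ solve 4 (λ x a b c → x :* a :* (b :* c) := x :* b :* (a :* c))
                                                         refl x (f Fin.zero) (pow x k) (∏ (f ∘ Fin.suc)) ⟩
    x * pow x k * (f Fin.zero * ∏ (f ∘ Fin.suc))   ∎

  ∏-bijection : (g σ τ : Carrier → Carrier) → (∀ x → σ (τ x) ≡ x) → (∀ x → τ (σ x) ≡ x) →
                ∏ (g ∘ enumerate) ≡ ∏ (g ∘ σ ∘ enumerate)
  ∏-bijection g σ τ στ τσ = trans (∏-permute (g ∘ enumerate) π) (∏-cong (cong g ∘ enumerate-index ∘ σ ∘ enumerate))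
    where
    lift : (Carrier → Carrier) → Fin (suc n) → Fin (suc n)
    lift h = index ∘ h ∘ enumerate
    lift-inverse : ∀ {h h′} → (∀ x → h (h′ x) ≡ x) → ∀ i → lift h (lift h′ i) ≡ i
    lift-inverse {h} {h′} hh′ i = begin
      index (h (enumerate (index (h′ (enumerate i)))))  ≡⟨ cong (index ∘ h) (enumerate-index _) ⟩
      index (h (h′ (enumerate i)))                      ≡⟨ cong index (hh′ _) ⟩
      index (enumerate i)                               ≡⟨ enumerate-injective (enumerate-index _) ⟩
      i                                                 ∎
    π = Permutation.permutation (lift σ) (lift τ) (lift-inverse {σ} στ) (lift-inverse {τ} τσ)

  zeroIndex : Fin (suc n)
  zeroIndex = index 0#

  nonzero : Fin n → Carrier
  nonzero = enumerate ∘ Fin.punchIn zeroIndex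

  nonzero-≢0 : ∀ j → nonzero j ≢ 0#
  nonzero-≢0 j eq = Finₚ.punchInᵢ≢i zeroIndex j (enumerate-injective (trans eq (sym (enumerate-index 0#))))

  ∏-nonzero : ∀ g → g 0# ≡ 1# → ∏ (g ∘ enumerate) ≡ ∏ (g ∘ nonzero)
  ∏-nonzero g g0≡1 = begin
    ∏ (g ∘ enumerate)                           ≡⟨ ∏-remove {i = zeroIndex} (g ∘ enumerate) ⟩
    g (enumerate zeroIndex) * ∏ (g ∘ nonzero)   ≡⟨ cong (λ y → g y * ∏ (g ∘ nonzero)) (enumerate-index 0#) ⟩
    g 0# * ∏ (g ∘ nonzero)                      ≡⟨ cong (_* ∏ (g ∘ nonzero)) g0≡1 ⟩
    1# * ∏ (g ∘ nonzero)                        ≡⟨ *-identityˡ _ ⟩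
    ∏ (g ∘ nonzero)                             ∎

  -- Its product over all of F is the product of the units.
  unzero : Carrier → Carrier
  unzero y with y ≟ 0#
  ... | yes _ = 1#
  ... | no  _ = y

  unzero-0 : unzero 0# ≡ 1#
  unzero-0 with 0# ≟ 0#
  ... | yes _   = refl
  ... | no  0≢0 = ⊥-elim (0≢0 refl)

  unzero-≢0 : ∀ {y} → y ≢ 0# → unzero y ≡ y
  unzero-≢0 {y} y≢0 with y ≟ 0#
  ... | yes y≡0 = ⊥-elim (y≢0 y≡0)
  ... | no  _   = refl

  -- Multiplication by x permutes the units, so x ^ n times their product is their product.
  x^n≡1 : ∀ {x} → x ≢ 0# → pow x n ≡ 1#
  x^n≡1 {x} x≢0 = x*y≡y⇒x≡1 (∏-≢0 nonzero nonzero-≢0) (begin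
    pow x n * ∏ nonzero                     ≡⟨ ∏-scale x nonzero ⟨
    ∏ (λ j → x * nonzero j)                 ≡⟨ ∏-cong (λ j → unzero-≢0 (*-≢0 x≢0 (nonzero-≢0 j))) ⟨
    ∏ (unzero ∘ (x *_) ∘ nonzero)           ≡⟨ ∏-nonzero (unzero ∘ (x *_)) (trans (cong unzero (zeroʳ x)) unzero-0) ⟨
    ∏ (unzero ∘ (x *_) ∘ enumerate)         ≡⟨ ∏-bijection unzero (x *_) (inv x x≢0 *_) (cancel (*-inverseʳ x x≢0))
                                                 (cancel (*-inverseˡ x x≢0)) ⟨
    ∏ (unzero ∘ enumerate)                  ≡⟨ ∏-nonzero unzero unzero-0 ⟩
    ∏ (unzero ∘ nonzero)                    ≡⟨ ∏-cong (unzero-≢0 ∘ nonzero-≢0) ⟩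
    ∏ nonzero                               ∎)
    where
    cancel : ∀ {a b} → a * b ≡ 1# → ∀ y → a * (b * y) ≡ y
    cancel {a} {b} ab≡1 y = trans (sym (*-assoc a b y)) (trans (cong (_* y) ab≡1) (*-identityˡ y))

module FiniteField (F : Field) {q : ℕ} (size : FieldSize F q) where
  open Field F
  open FieldProperties F
  open TotalEnumeration size public
  open IsCommutativeRing isCommutativeRing using (+-identityˡ; -‿inverseˡ; zeroˡ; zeroʳ)
  open ≡-Reasoning

  2≤q : 2 ≤ q
  2≤q = 2≤size size tt tt

  pow[q-1]≡1 : ∀ {x} → x ≢ 0# → pow x (q ℕ.∸ 1) ≡ 1#
  pow[q-1]≡1 = lagrange size
    where
    lagrange : ∀ {q} → FieldSize F q → ∀ {x} → x ≢ 0# → pow x (q ℕ.∸ 1) ≡ 1#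
    lagrange {zero}  size = ⊥-elim (Finₚ.¬Fin0 (TotalEnumeration.index size 0#))
    lagrange {suc n} size = Lagrange.x^n≡1 F size

  -- Otherwise y ^ (m + 2) - y, which has m + 3 ≤ q coefficients, would vanish at all q points of F.
  ∃pow≢1 : ∀ m → suc m ℕ.+ 2 ≤ q → ∃ λ y → y ≢ 0# × pow y (suc m) ≢ 1#
  ∃pow≢1 m bound with ∃? (λ y → ¬? (y ≟ 0#) ×-dec ¬? (pow y (suc m) ≟ 1#))
  ... | yes witness = witness
  ... | no  none    = ⊥-elim (monomial-≢0 m (lower-coefficients
        (vanishing⇒zero (tabulate enumerate) f
          (AllPairsₚ.tabulate⁺ (λ i≢j → i≢j ∘ enumerate-injective))
          length-f≤q
          (Allₚ.tabulate⁺ (λ i → f-vanishes (enumerate i))))))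
    where
    f = 0# ∷ - 1# ∷ monomial m
    lower-coefficients : All (_≡ 0#) f → All (_≡ 0#) (monomial m)
    lower-coefficients (_ ∷ _ ∷ zs) = zs
    length-f≤q : length f ≤ length (tabulate enumerate)
    length-f≤q rewrite length-monomial m | Listₚ.length-tabulate enumerate = subst (_≤ q) (ℕₚ.+-comm (suc m) 2) bound
    f-vanishes : ∀ y → eval f y ≡ 0#
    f-vanishes y with y ≟ 0#
    ... | yes refl = trans (+-identityˡ _) (zeroˡ _)
    ... | no  y≢0  = begin
      0# + y * (- 1# + y * eval (monomial m) y)   ≡⟨ +-identityˡ _ ⟩
      y * (- 1# + y * eval (monomial m) y)        ≡⟨ cong (λ t → y * (- 1# + y * t)) (eval-monomial m y) ⟩
      y * (- 1# + pow y (suc m))                  ≡⟨ cong (λ t → y * (- 1# + t)) yᵐ⁺¹≡1 ⟩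
      y * (- 1# + 1#)                             ≡⟨ cong (y *_) (-‿inverseˡ 1#) ⟩
      y * 0#                                      ≡⟨ zeroʳ y ⟩
      0#                                          ∎
      where
      yᵐ⁺¹≡1 : pow y (suc m) ≡ 1#
      yᵐ⁺¹≡1 = Dec.decidable-stable (pow y (suc m) ≟ 1#) (λ yᵐ⁺¹≢1 → none (y , y≢0 , yᵐ⁺¹≢1))

  ∃nonDthPower : ∀ {d} → 1 < d → d ∣ q ℕ.∸ 1 → ∃ λ ξ → ξ ≢ 0# × ¬ IsDthPower F d ξ
  ∃nonDthPower 1<d (divides zero q-1≡0) with subst (1 ≤_) q-1≡0 (ℕₚ.∸-monoˡ-≤ 1 2≤q)
  ... | ()
  ∃nonDthPower {d} 1<d (divides (suc m) q-1≡) with ∃pow≢1 m (cofactor-bound 2≤q 1<d q-1≡)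
  ... | y , y≢0 , yᵐ⁺¹≢1 = y , y≢0 , λ (x , x≢0 , xᵈ≡y) → yᵐ⁺¹≢1 (begin
    pow y (suc m)          ≡⟨ cong (λ t → pow t (suc m)) xᵈ≡y ⟨
    pow (pow x d) (suc m)  ≡⟨ pow-pow x d (suc m) ⟩
    pow x (d ℕ.* suc m)    ≡⟨ cong (pow x) (trans (ℕₚ.*-comm d (suc m)) (sym q-1≡)) ⟩
    pow x (q ℕ.∸ 1)        ≡⟨ pow[q-1]≡1 x≢0 ⟩
    1#                     ∎)

module SubfieldSpan (F : Field) {K : Pred (Field.Carrier F) 0ℓ} (K-subfield : IsSubfield F K) where
  open Field F
  open FieldProperties F
  open IsCommutativeRing isCommutativeRing
    using (+-identityˡ; +-identityʳ; -‿inverseʳ; *-assoc; *-identityˡ; *-identityʳ;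
           distribˡ; distribʳ; zeroˡ; zeroʳ)
  open import Algebra.Solver.Ring.NaturalCoefficients.Default (CommutativeRing.commutativeSemiring commutativeRing)
  open ≡-Reasoning

  K-0 : K 0#
  K-0 = proj₁ K-subfield

  K-1 : K 1#
  K-1 = proj₁ (proj₂ K-subfield)

  K-+ : ∀ {x y} → K x → K y → K (x + y)
  K-+ = proj₁ (proj₂ (proj₂ K-subfield))

  K-neg : ∀ {x} → K x → K (- x)
  K-neg = proj₁ (proj₂ (proj₂ (proj₂ K-subfield)))

  K-* : ∀ {x y} → K x → K y → K (x * y)
  K-* = proj₁ (proj₂ (proj₂ (proj₂ (proj₂ K-subfield))))

  K-inv : ∀ {x} (x≢0 : x ≢ 0#) → K x → K (inv x x≢0)
  K-inv x≢0 x∈K = proj₂ (proj₂ (proj₂ (proj₂ (proj₂ K-subfield)))) x≢0 x∈K (*-inverseʳ _ x≢0)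

  K-- : ∀ {x y} → K x → K y → K (x - y)
  K-- x∈K y∈K = K-+ x∈K (K-neg y∈K)

  linComb-0 : ∀ {n} (b : Fin n → Carrier) → linComb (λ _ → 0#) b ≡ 0#
  linComb-0 {zero}  b = refl
  linComb-0 {suc n} b = trans (cong₂ _+_ (zeroˡ _) (linComb-0 (b ∘ Fin.suc))) (+-identityʳ 0#)

  linComb-+ : ∀ {n} (c c′ b : Fin n → Carrier) → linComb (λ i → c i + c′ i) b ≡ linComb c b + linComb c′ b
  linComb-+ {zero}  c c′ b = sym (+-identityʳ 0#)
  linComb-+ {suc n} c c′ b = begin
    (c₀ + c′₀) * b₀ + linComb (λ i → c (Fin.suc i) + c′ (Fin.suc i)) (b ∘ Fin.suc)
      ≡⟨ cong₂ _+_ (distribʳ b₀ c₀ c′₀) (linComb-+ (c ∘ Fin.suc) (c′ ∘ Fin.suc) (b ∘ Fin.suc)) ⟩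
    (c₀ * b₀ + c′₀ * b₀) + (linComb (c ∘ Fin.suc) (b ∘ Fin.suc) + linComb (c′ ∘ Fin.suc) (b ∘ Fin.suc))
      ≡⟨ solve 4 (λ a a′ r r′ → (a :+ a′) :+ (r :+ r′) := (a :+ r) :+ (a′ :+ r′)) refl _ _ _ _ ⟩
    (c₀ * b₀ + linComb (c ∘ Fin.suc) (b ∘ Fin.suc)) + (c′₀ * b₀ + linComb (c′ ∘ Fin.suc) (b ∘ Fin.suc))
      ∎
    where
    c₀ = c Fin.zero
    c′₀ = c′ Fin.zero
    b₀ = b Fin.zero

  linComb-* : ∀ {n} a (c b : Fin n → Carrier) → linComb (λ i → a * c i) b ≡ a * linComb c b
  linComb-* {zero}  a c b = sym (zeroʳ a)
  linComb-* {suc n} a c b =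
    trans (cong₂ _+_ (*-assoc a _ _) (linComb-* a (c ∘ Fin.suc) (b ∘ Fin.suc))) (sym (distribˡ a _ _))

  linComb-neg : ∀ {n} (c b : Fin n → Carrier) → linComb (λ i → - c i) b ≡ - linComb c b
  linComb-neg {zero}  c b = sym -0#≈0#
  linComb-neg {suc n} c b =
    trans (cong₂ _+_ (sym (-‿distribˡ-* _ _)) (linComb-neg (c ∘ Fin.suc) (b ∘ Fin.suc))) (-‿+-comm _ _)

  δ : ∀ {n} → Fin n → Fin n → Carrier
  δ Fin.zero    Fin.zero    = 1#
  δ Fin.zero    (Fin.suc j) = 0#
  δ (Fin.suc i) Fin.zero    = 0#
  δ (Fin.suc i) (Fin.suc j) = δ i j

  δ∈K : ∀ {n} (i j : Fin n) → K (δ i j)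
  δ∈K Fin.zero    Fin.zero    = K-1
  δ∈K Fin.zero    (Fin.suc j) = K-0
  δ∈K (Fin.suc i) Fin.zero    = K-0
  δ∈K (Fin.suc i) (Fin.suc j) = δ∈K i j

  linComb-δ : ∀ {n} (i : Fin n) (b : Fin n → Carrier) → linComb (δ i) b ≡ b i
  linComb-δ Fin.zero    b = trans (cong₂ _+_ (*-identityˡ _) (linComb-0 (b ∘ Fin.suc))) (+-identityʳ _)
  linComb-δ (Fin.suc i) b = trans (cong₂ _+_ (zeroˡ _) (linComb-δ i (b ∘ Fin.suc))) (+-identityˡ _)

  ∷-∈K : ∀ {n a} {c : Fin n → Carrier} → K a → (∀ i → K (c i)) → ∀ i → K ((a V.∷ c) i)
  ∷-∈K a∈K c∈K Fin.zero    = a∈K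
  ∷-∈K a∈K c∈K (Fin.suc i) = c∈K i

  Span : ∀ {n} → (Fin n → Carrier) → Pred Carrier 0ℓ
  Span {n} b x = Σ (Fin n → Carrier) λ c → (∀ i → K (c i)) × linComb c b ≡ x

  Independent : ∀ {n} → (Fin n → Carrier) → Set
  Independent {n} b = ∀ (c : Fin n → Carrier) → (∀ i → K (c i)) → linComb c b ≡ 0# → ∀ i → c i ≡ 0#

  module _ {n} (b : Fin n → Carrier) where

    span-0 : Span b 0#
    span-0 = (λ _ → 0#) , (λ _ → K-0) , linComb-0 b

    span-+ : ∀ {x y} → Span b x → Span b y → Span b (x + y)
    span-+ (c , c∈K , refl) (c′ , c′∈K , refl) = (λ i → c i + c′ i) , (λ i → K-+ (c∈K i) (c′∈K i)) , linComb-+ c c′ b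

    span-* : ∀ {a x} → K a → Span b x → Span b (a * x)
    span-* {a} a∈K (c , c∈K , refl) = (λ i → a * c i) , (λ i → K-* a∈K (c∈K i)) , linComb-* a c b

    span-neg : ∀ {x} → Span b x → Span b (- x)
    span-neg (c , c∈K , refl) = (λ i → - c i) , (λ i → K-neg (c∈K i)) , linComb-neg c b

    span-- : ∀ {x y} → Span b x → Span b y → Span b (x - y)
    span-- x∈V y∈V = span-+ x∈V (span-neg y∈V)

    span-generator : ∀ i → Span b (b i)
    span-generator i = δ i , δ∈K i , linComb-δ i b

    span-isSubspace : IsSubspace F K (Span b)
    span-isSubspace = span-0 , span-+ , span-*

    span-isBasis : Independent b → IsBasis F K (Span b) b
    span-isBasis independent = span-generator , (λ _ x∈V → x∈V) , independent

    span-∷ : ∀ {v x} → Span b x → Span (v V.∷ b) x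
    span-∷ {v} (c , c∈K , refl) = (0# V.∷ c) , ∷-∈K K-0 c∈K , trans (cong (_+ linComb c b) (zeroˡ v)) (+-identityˡ _)

  one : Fin 1 → Carrier
  one _ = 1#

  span-one⁺ : ∀ {x} → K x → Span one x
  span-one⁺ {x} x∈K = (λ _ → x) , (λ _ → x∈K) , trans (+-identityʳ _) (*-identityʳ x)

  span-one⁻ : ∀ {x} → Span one x → K x
  span-one⁻ (c , c∈K , refl) = subst K (sym (trans (+-identityʳ _) (*-identityʳ _))) (c∈K Fin.zero)

  independent-one : Independent one
  independent-one c _ c₀≡0 Fin.zero = trans (sym (*-identityʳ _)) (trans (sym (+-identityʳ _)) c₀≡0)

  independent-∷ : DecidableEquality Carrier → ∀ {n} {b : Fin n → Carrier} {v} →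
                  Independent b → ¬ Span b v → Independent (v V.∷ b)
  independent-∷ _≟_ {b = b} {v} independent v∉V c c∈K lin≡0 = c≡0
    where
    c₀ = c Fin.zero
    rest = linComb (c ∘ Fin.suc) b
    rest∈V : Span b rest
    rest∈V = c ∘ Fin.suc , c∈K ∘ Fin.suc , refl
    c₀≡0 : c₀ ≡ 0#
    c₀≡0 with c₀ ≟ 0#
    ... | yes c₀≡0 = c₀≡0
    ... | no  c₀≢0 = ⊥-elim (v∉V (subst (Span b) v≡ (span-* b (K-inv c₀≢0 (c∈K Fin.zero)) (span-neg b rest∈V))))
      where
      v≡ : inv c₀ c₀≢0 * (- rest) ≡ v
      v≡ = begin
        inv c₀ c₀≢0 * (- rest)    ≡⟨ cong (inv c₀ c₀≢0 *_) (+-inverseˡ-unique (c₀ * v) rest lin≡0) ⟨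
        inv c₀ c₀≢0 * (c₀ * v)    ≡⟨ *-assoc _ c₀ v ⟨
        inv c₀ c₀≢0 * c₀ * v      ≡⟨ cong (_* v) (*-inverseˡ c₀ c₀≢0) ⟩
        1# * v                    ≡⟨ *-identityˡ v ⟩
        v                         ∎
    rest≡0 : rest ≡ 0#
    rest≡0 = trans (sym (+-identityˡ rest)) (trans (cong (_+ rest) (sym (trans (cong (_* v) c₀≡0) (zeroˡ v)))) lin≡0)
    c≡0 : ∀ i → c i ≡ 0#
    c≡0 Fin.zero    = c₀≡0
    c≡0 (Fin.suc i) = independent (c ∘ Fin.suc) (c∈K ∘ Fin.suc) rest≡0 i

  clique-∷ : DecidableEquality Carrier → ∀ {d n} {b : Fin n → Carrier} {v} →
             IsClique F d K → IsClique F d (Span b) → (∀ u → Span b u → IsDthPower F d (v - u)) →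
             IsClique F d (Span (v V.∷ b))
  clique-∷ _≟_ {d} {b = b} {v} K-clique V-clique v-adjacent (c , c∈K , refl) (c′ , c′∈K , refl) =
    adjacent (c∈K Fin.zero) (c′∈K Fin.zero) (c ∘ Fin.suc , c∈K ∘ Fin.suc , refl) (c′ ∘ Fin.suc , c′∈K ∘ Fin.suc , refl)
    where
    adjacent : ∀ {a a′ w w′} → K a → K a′ → Span b w → Span b w′ →
               a * v + w ≢ a′ * v + w′ → IsDthPower F d ((a * v + w) - (a′ * v + w′))
    adjacent {a} {a′} {w} {w′} a∈K a′∈K w∈V w′∈V x≢x′ with a ≟ a′
    ... | yes refl = subst (IsDthPower F d) (sym same-coefficient) (V-clique w∈V w′∈V (x≢x′ ∘ cong (a * v +_)))
      where
      same-coefficient : (a * v + w) - (a * v + w′) ≡ w - w′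
      same-coefficient = begin
        (a * v + w) - (a * v + w′)   ≡⟨ [x+y]-[z+w]≡[x-z]+[y-w] (a * v) w (a * v) w′ ⟩
        (a * v - a * v) + (w - w′)   ≡⟨ cong (_+ (w - w′)) (-‿inverseʳ (a * v)) ⟩
        0# + (w - w′)                ≡⟨ +-identityˡ _ ⟩
        w - w′                       ∎
    ... | no a≢a′ = subst (IsDthPower F d) (sym difference) (dthPower-* d αᵈ (v-adjacent u u∈V))
      where
      α = a - a′
      α≢0 = x≢y⇒x-y≢0 a≢a′
      α∈K = K-- a∈K a′∈K
      αᵈ : IsDthPower F d α
      αᵈ = subst (IsDthPower F d) (trans (cong (α +_) -0#≈0#) (+-identityʳ α)) (K-clique α∈K K-0 α≢0)
      u = inv α α≢0 * (w′ - w)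
      u∈V : Span b u
      u∈V = span-* b (K-inv α≢0 α∈K) (span-- b w′∈V w∈V)
      αu≡w′-w : α * u ≡ w′ - w
      αu≡w′-w = trans (sym (*-assoc α _ _)) (trans (cong (_* (w′ - w)) (*-inverseʳ α α≢0)) (*-identityˡ _))
      difference : (a * v + w) - (a′ * v + w′) ≡ α * (v - u)
      difference = begin
        (a * v + w) - (a′ * v + w′)    ≡⟨ [x+y]-[z+w]≡[x-z]+[y-w] (a * v) w (a′ * v) w′ ⟩
        (a * v - a′ * v) + (w - w′)    ≡⟨ cong₂ _+_ ([y-z]x≈yx-zx v a a′) (⁻¹-anti-homo‿- w′ w) ⟨
        α * v - (w′ - w)               ≡⟨ cong (λ t → α * v - t) αu≡w′-w ⟨
        α * v - α * u                  ≡⟨ x[y-z]≈xy-xz α v u ⟨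
        α * (v - u)                    ∎

  span? : DecidableEquality Carrier → ∀ {k} → HasSize K k → ∀ {n} (b : Fin n → Carrier) → Decidable (Span b)
  span? _≟_ K-size {zero} b x = Dec.map′ (λ 0≡x → (λ ()) , (λ ()) , 0≡x) (proj₂ ∘ proj₂) (0# ≟ x)
  span? _≟_ K-size {suc n} b x = Dec.map′ to from (Enumeration.∃? K-size λ a → span? _≟_ K-size b′ (x - a * b₀))
    where
    b₀ = b Fin.zero
    b′ = b ∘ Fin.suc
    to : ∃ (λ a → K a × Span b′ (x - a * b₀)) → Span b x
    to (a , a∈K , c , c∈K , eq) = (a V.∷ c) , ∷-∈K a∈K c∈K , trans (cong (a * b₀ +_) eq) (x+[y-x]≡y (a * b₀) x)
    from : Span b x → ∃ (λ a → K a × Span b′ (x - a * b₀))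
    from (c , c∈K , eq) = c Fin.zero , c∈K Fin.zero , c ∘ Fin.suc , c∈K ∘ Fin.suc , x+y≡z⇒y≡z-x eq

  module Counting {k} (K-size : HasSize K k) where
    open Enumeration K-size using ()
      renaming (enumerate to scalar; enumerate-injective to scalar-injective; enumerate-∈ to scalar∈K)

    element : ∀ {n} → (Fin n → Carrier) → Fin (k ℕ.^ n) → Carrier
    element b a = linComb (scalar ∘ Fin.finToFun a) b

    element∈span : ∀ {n} (b : Fin n → Carrier) a → Span b (element b a)
    element∈span b a = scalar ∘ Fin.finToFun a , scalar∈K ∘ Fin.finToFun a , refl

    element-injective : ∀ {n} {b : Fin n → Carrier} → Independent b → Injective _≡_ _≡_ (element b)
    element-injective {n} {b} independent {a} {a′} eq =
      finToFun-injective {k} {n} λ i → scalar-injective (x-y≡0⇒x≡y (independent diff diff∈K combination≡0 i))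
      where
      diff : Fin n → Carrier
      diff i = scalar (Fin.finToFun a i) - scalar (Fin.finToFun a′ i)
      diff∈K : ∀ i → K (diff i)
      diff∈K i = K-- (scalar∈K _) (scalar∈K _)
      combination≡0 : linComb diff b ≡ 0#
      combination≡0 = begin
        linComb diff b                             ≡⟨ linComb-+ _ _ b ⟩
        element b a + linComb (λ i → - _) b        ≡⟨ cong (element b a +_) (linComb-neg _ b) ⟩
        element b a - element b a′                 ≡⟨ cong (λ t → element b a - t) eq ⟨
        element b a - element b a                  ≡⟨ -‿inverseʳ _ ⟩
        0#                                         ∎

    -- If ξ is not a d-th power, x + ξ y determines x and y, so the q elements of F include |V|² distinct ones.
    clique-span-size²≤q : ∀ {q} → FieldSize F q → ∀ {d n} {b : Fin n → Carrier} → Independent b →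
                          IsClique F d (Span b) → ∀ {ξ} → ξ ≢ 0# → ¬ IsDthPower F d ξ →
                          k ℕ.^ n ℕ.* k ℕ.^ n ≤ q
    clique-span-size²≤q size {d} {n} {b} independent clique {ξ} ξ≢0 ξ-nonpower =
      TotalEnumeration.injection⇒≤ size pair pair-injective
      where
      pair : Fin (k ℕ.^ n ℕ.* k ℕ.^ n) → Carrier
      pair i = element b (Fin.quotient (k ℕ.^ n) i) + ξ * element b (Fin.remainder {k ℕ.^ n} (k ℕ.^ n) i)
      pair-injective : Injective _≡_ _≡_ pair
      pair-injective {i} {j} eq with clique-x+ξy-injective d (TotalEnumeration._≟_ size) clique ξ≢0 ξ-nonpower
                                       (element∈span b _) (element∈span b _) (element∈span b _) (element∈span b _) eq
      ... | quotients≡ , remainders≡ =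
        remQuot-injective {k ℕ.^ n} (k ℕ.^ n) (cong₂ _,_ (element-injective independent quotients≡)
                                                         (element-injective independent remainders≡))

module GreedyClique (F : Field) {q} (size : FieldSize F q)
                    {K : Pred (Field.Carrier F) 0ℓ} (K-subfield : IsSubfield F K) {k} (K-size : HasSize K k)
                    {d} (K-clique : IsClique F d K)
                    {ξ} (ξ≢0 : ξ ≢ Field.0# F) (ξ-nonpower : ¬ IsDthPower F d ξ) where
  open Field F
  open FieldProperties F using (2≤size)
  open FiniteField F size using (_≟_; ∃?; ∀?)
  open SubfieldSpan F K-subfield
  open Counting K-size

  dthPower? : Decidable (IsDthPower F d)
  dthPower? z = ∃? λ x → ¬? (x ≟ 0#) ×-dec (pow x d ≟ z)

  Extends : ∀ {n} → (Fin n → Carrier) → Carrier → Set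
  Extends b v = ¬ Span b v × (∀ u → Span b u → IsDthPower F d (v - u))

  extends? : ∀ {n} (b : Fin n → Carrier) → Dec (∃ (Extends b))
  extends? b = ∃? λ v → ¬? (span? _≟_ K-size b v) ×-dec ∀? λ u → span? _≟_ K-size b u →-dec dthPower? (v - u)

  record Stage : Set where
    constructor stage
    field
      {n}         : ℕ
      basis       : Fin n → Carrier
      independent : Independent basis
      K⊆span      : K ⊆ Span basis
      clique      : IsClique F d (Span basis)

  open Stage

  initial : Stage
  initial = stage one independent-one span-one⁺ λ x∈V y∈V → K-clique (span-one⁻ x∈V) (span-one⁻ y∈V)

  extend : (s : Stage) → ∃ (Extends (basis s)) → Stage
  extend (stage b b-independent K⊆V V-clique) (v , v∉V , v-adjacent) =
    stage (v V.∷ b) (independent-∷ _≟_ b-independent v∉V) (span-∷ b ∘ K⊆V) (clique-∷ _≟_ {d} K-clique V-clique v-adjacent)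

  unextendable⇒maximal : ∀ (s : Stage) → ¬ ∃ (Extends (basis s)) → IsMaximalClique F d (Span (basis s))
  unextendable⇒maximal s unextendable = clique s , λ z z∉V larger-clique →
    unextendable (z , z∉V , λ u u∈V → larger-clique (inj₂ refl) (inj₁ u∈V) (λ { refl → z∉V u∈V }))

  n<q : ∀ (s : Stage) → n s < q
  n<q s = begin-strict
    n s                         <⟨ n<kⁿ ⟩
    k ℕ.^ n s                   ≡⟨ ℕₚ.*-identityʳ _ ⟨
    k ℕ.^ n s ℕ.* 1             ≤⟨ ℕₚ.*-monoʳ-≤ (k ℕ.^ n s) (ℕₚ.≤-trans (ℕ.s≤s ℕ.z≤n) n<kⁿ) ⟩
    k ℕ.^ n s ℕ.* k ℕ.^ n s     ≤⟨ clique-span-size²≤q size {d} (independent s) (clique s) ξ≢0 ξ-nonpower ⟩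
    q                           ∎
    where
    open ℕₚ.≤-Reasoning
    n<kⁿ = n<m^n (n s) (2≤size K-size K-0 K-1)

  -- Each extension raises the dimension, which stays below q, so fuel q suffices.
  grow : ∀ fuel (s : Stage) → q ≤ n s ℕ.+ fuel → Σ Stage λ s → IsMaximalClique F d (Span (basis s))
  grow zero s q≤n = ⊥-elim (ℕₚ.<⇒≱ (n<q s) (subst (q ≤_) (ℕₚ.+-identityʳ (n s)) q≤n))
  grow (suc fuel) s q≤n+fuel with extends? (basis s)
  ... | yes extension   = grow fuel (extend s extension) (subst (q ≤_) (ℕₚ.+-suc (n s) fuel) q≤n+fuel)
  ... | no  unextendable = s , unextendable⇒maximal s unextendable

  maximalCliqueStage : Σ Stage λ s → IsMaximalClique F d (Span (basis s))
  maximalCliqueStage = grow q initial (ℕₚ.m≤n+m q 1)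

maximalCliqueSubspace :
  (F : Field) {q d k : ℕ} → FieldSize F q → 1 < d → d ∣ q ℕ.∸ 1 →
  (K : Pred (Field.Carrier F) 0ℓ) → IsSubfield F K → HasSize K k → IsClique F d K →
  Σ (Pred (Field.Carrier F) 0ℓ) λ V →
    IsSubspace F K V × K ⊆ V ×
    (Σ ℕ λ n → Σ (Fin n → Field.Carrier F) λ b → IsBasis F K V b × k ℕ.^ n ℕ.* k ℕ.^ n ≤ q) ×
    IsMaximalClique F d V
maximalCliqueSubspace F {d = d} size 1<d d∣q-1 K K-subfield K-size K-clique
  with FiniteField.∃nonDthPower F size 1<d d∣q-1
... | ξ , ξ≢0 , ξ-nonpower with GreedyClique.maximalCliqueStage F size K-subfield K-size {d} K-clique ξ≢0 ξ-nonpower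
... | GreedyClique.stage b b-independent K⊆V V-clique , V-maximal =
  Span b , span-isSubspace b , K⊆V ,
  (_ , b , span-isBasis b b-independent , clique-span-size²≤q size {d} b-independent V-clique ξ≢0 ξ-nonpower) ,
  V-maximal
  where
  open SubfieldSpan F K-subfield
  open Counting K-size

open import Data.Nat using (_*_; _^_; _∸_)

corollary3p1 : (t d s p : ℕ) → 0 < t → 1 < d → 0 < s → Prime p →
    2 * d ∣ p ^ s ∸ 1 →
    (F : Field) → FieldSize F (p ^ s) →
    (K : Pred (Field.Carrier F) 0ℓ) → IsSubfield F K → IsProper F K → HasSize K (p ^ t) →
    IsClique F d K →
    Σ (Pred (Field.Carrier F) 0ℓ) λ V →
      IsSubspace F K V × K ⊆ V ×
      (Σ ℕ λ n → Σ (Fin n → Field.Carrier F) λ b → IsBasis F K V b × 2 * t * n ≤ s) ×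
      IsMaximalClique F d V
corollary3p1 t d s p _ 1<d _ p-prime 2d∣q-1 F size K K-subfield _ K-size K-clique
  with maximalCliqueSubspace F size 1<d (Div.∣-trans (Div.n∣m*n 2) 2d∣q-1) K K-subfield K-size K-clique
... | V , V-subspace , K⊆V , (n , b , b-basis , |V|²≤q) , V-maximal =
  V , V-subspace , K⊆V , (n , b , b-basis , 2tn≤s) , V-maximal
  where
  2tn≤s : 2 * t * n ≤ s
  2tn≤s = ^-cancelʳ-≤ (ℕ.nonTrivial⇒n>1 p {{prime⇒nonTrivial p-prime}})
            (subst (_≤ p ^ s) ([pᵗ]ⁿ*[pᵗ]ⁿ≡p^[2tn] p t n) |V|²≤q)
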